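{- Let $m=m(t)$ be a positive integer depending on $t$ with $t \le m(t) \le 2^{t/16}$. Then for all sufficiently large $t$, log-concavity of the independent set sequence of $T_{m,t,1}$ is broken at $mt+2$; that is, $$ \big(i_{mt+2}(T_{m,t,1})\big)^2 < i_{mt+1}(T_{m,t,1})\, i_{mt+3}(T_{m,t,1}). $$
   Context: For positive integers $m,t$, the rooted tree $T_{m,t,1}$ is defined as follows: the root $v$ has $m$ children $w_1,\dots,w_m$; each $w_i$ has $t$ children $x_i^1,\dots,x_i^t$; and each $x_i^j$ has exactly one child $y_i^j$, which is a leaf. (So $T_{m,t,1}$ has $1+m+2mt$ vertices.) For a graph $G$, an independent set is a set of vertices no two of which are adjacent, and $i_k(G)$ denotes the number of independent sets in $G$ of cardinality $k$. Log-concavity of a positive sequence $(a_k)$ is said to be broken at $k$ if $a_k^2 < a_{k-1}a_{k+1}$. -}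

module Defs where

open import Data.Nat using (ℕ; zero; suc; _+_; _*_)
open import Data.Bool using (Bool; true; false; not; _∧_; if_then_else_)
open import Data.Fin using (Fin)
open import Data.Fin.Properties using (_≟_)
open import Data.List using (List; []; _∷_; _++_; map; length; concatMap; allFin)
open import Relation.Nullary.Decidable using (⌊_⌋)

-- A finite simple graph: vertex type, an explicit duplicate-free enumeration
-- of all vertices, and a (symmetric, irreflexive) Boolean adjacency test.
record FinGraph : Set₁ where
  field
    V     : Set
    verts : List V
    adj   : V → V → Bool

-- all sublists of a list (2^n of them); for a duplicate-free enumeration of
-- the vertex set these are exactly the vertex subsets, each listed once
sublists : {A : Set} → List A → List (List A)
sublists []       = [] ∷ []
sublists (x ∷ xs) = sublists xs ++ map (x ∷_) (sublists xs)

allB : {A : Set} → (A → Bool) → List A → Bool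
allB p []       = true
allB p (x ∷ xs) = p x ∧ allB p xs

independent : {A : Set} → (A → A → Bool) → List A → Bool
independent adj []      = true
independent adj (u ∷ s) = allB (λ v → not (adj u v)) s ∧ independent adj s

countB : {A : Set} → (A → Bool) → List A → ℕ
countB p []       = 0
countB p (x ∷ xs) = if p x then suc (countB p xs) else countB p xs

indepCount : FinGraph → ℕ → ℕ
indepCount G k =
  countB (λ S → ⌊ length S Data.Nat.≟ k ⌋ ∧ independent adj S) (sublists verts)
  where open FinGraph G

data TVtx (m t : ℕ) : Set where
  root : TVtx m t
  w    : Fin m → TVtx m t
  x    : Fin m → Fin t → TVtx m t
  y    : Fin m → Fin t → TVtx m t

edge : {m t : ℕ} → TVtx m t → TVtx m t → Bool
edge root    (w i)    = true
edge (w i)   (x i' j) = ⌊ i ≟ i' ⌋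
edge (x i j) (y i' j') = ⌊ i ≟ i' ⌋ ∧ ⌊ j ≟ j' ⌋
edge _       _        = false

tAdj : {m t : ℕ} → TVtx m t → TVtx m t → Bool
tAdj u v = if edge u v then true else edge v u

tVerts : (m t : ℕ) → List (TVtx m t)
tVerts m t =
  root ∷ (map w (allFin m)
       ++ (concatMap (λ i → map (x i) (allFin t)) (allFin m)
       ++ concatMap (λ i → map (y i) (allFin t)) (allFin m)))

T : ℕ → ℕ → FinGraph
T m t = record { V = TVtx m t ; verts = tVerts m t ; adj = tAdj }

-- Adding an isolated vertex multiplies the independence polynomial by 1 + z and adding a
-- disjoint edge multiplies it by 1 + 2z. Deleting the root of T_{m,t,1} leaves m branches, each
-- with polynomial B = (1+2z)^t + z(1+z)^t, while deleting its closed neighbourhood leaves mt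
-- disjoint edges; hence I(T_{m,t,1}) = B^m + z(1+2z)^{mt}. With N = mt:
--   i_{N+1} ≥ [z^N] (1+2z)^N = 2^N;
--   i_{N+3} ≥ [z^{N+3}] B^m ≥ 2^{N-3t}  (three branches give z^{t+1}, the others 2^t z^t);
--   i_{N+2} = [z^{N+2}] B^m ≤ 2^{N-2t} m^3, because at least two branches must contribute
--   through z(1+z)^t, whose top coefficient is 1 rather than 2^t.
-- Thus i_{N+2}^2 ≤ 2^{2N-4t} m^6 < 2^{2N-3t} ≤ i_{N+1} i_{N+3} as soon as m^6 < 2^t.

module Submission where

open import Defs
open import Algebra.Bundles using (CommutativeMonoid)
open import Data.Bool using (Bool; true; false; not; _∧_)
open import Data.Bool.Properties using (∧-commutativeMonoid)
open import Algebra.Properties.CommutativeSemigroup (CommutativeMonoid.commutativeSemigroup ∧-commutativeMonoid)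
  using (x∙yz≈y∙xz; interchange)
open import Data.Empty using (⊥-elim)
open import Data.Fin using (Fin) renaming (zero to fzero; suc to fsuc)
open import Data.Fin.Properties using (_≟_; 0≢1+n) renaming (suc-injective to fsuc-injective)
open import Data.List using (List; []; _∷_; _++_; map; length; concatMap; tabulate; allFin; filterᵇ)
open import Data.List.Properties using (++-assoc)
open import Data.List.Relation.Unary.All using (All; []; _∷_)
open import Data.List.Relation.Unary.All.Properties using (++⁺; filter⁺)
import Data.List.Relation.Binary.Permutation.Propositional as ↭
open ↭ using (_↭_; prep; swap; ↭-reflexive; ↭-trans; module PermutationReasoning)
open import Data.List.Relation.Binary.Permutation.Propositional.Properties
  using (↭-length; shift; shifts) renaming (++⁺ to ++⁺-↭; ++⁺ˡ to ++⁺ˡ-↭)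
open import Data.Nat using (ℕ; zero; suc; _+_; _*_; _^_; _≤_; _<_; z≤n; s≤s; z<s; NonZero; >-nonZero)
  renaming (_≟_ to _≟ℕ_)
open import Data.Nat.Properties hiding (_≟_; 0≢1+n)
open import Data.Nat.Tactic.RingSolver using (solve-∀)
open import Data.Product using (Σ; _,_)
open import Function using (_∘_; id)
open import Function.Definitions using (Injective)
open import Relation.Binary.PropositionalEquality
open import Relation.Nullary.Decidable using (⌊_⌋; yes; no; isYes≗does; dec-true; dec-false; T?)

-- a sequence f stands for the generating function Σ_k f k z^k
Seq : Set
Seq = ℕ → ℕ

open import Function.Endo.Propositional Seq using () renaming (_^_ to _^ᵒ_; ^-homo to ^ᵒ-homo)

infixl 6 _⊕_

_⊕_ : Seq → Seq → Seq
(f ⊕ g) k = f k + g k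

one : Seq
one zero    = 1
one (suc _) = 0

mulLin : ℕ → ℕ → Seq → Seq
mulLin a b f zero    = a * f zero
mulLin a b f (suc k) = a * f (suc k) + b * f k

mulZ mul1+z mul1+2z : Seq → Seq
mulZ    = mulLin 0 1
mul1+z  = mulLin 1 1
mul1+2z = mulLin 1 2

Congruent Additive : (Seq → Seq) → Set
Congruent O = ∀ {f g} → f ≗ g → O f ≗ O g
Additive O  = ∀ f g → O (f ⊕ g) ≗ O f ⊕ O g

Commute : (Seq → Seq) → (Seq → Seq) → Set
Commute O O′ = ∀ f → O (O′ f) ≗ O′ (O f)

module _ {O : Seq → Seq} where

  ^ᵒ-congruent : Congruent O → ∀ n → Congruent (O ^ᵒ n)
  ^ᵒ-congruent cong-O zero    f≗g = f≗g
  ^ᵒ-congruent cong-O (suc n) f≗g = cong-O (^ᵒ-congruent cong-O n f≗g)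

  ^ᵒ-additive : Congruent O → Additive O → ∀ n → Additive (O ^ᵒ n)
  ^ᵒ-additive cong-O add-O zero    f g k = refl
  ^ᵒ-additive cong-O add-O (suc n) f g k =
    trans (cong-O (^ᵒ-additive cong-O add-O n f g) k) (add-O _ _ k)

  ^ᵒ-commute : ∀ {O′} → Congruent O → Congruent O′ → Commute O O′ → ∀ m n → Commute (O ^ᵒ m) (O′ ^ᵒ n)
  ^ᵒ-commute cong-O cong-O′ comm zero    n f k = refl
  ^ᵒ-commute {O′} cong-O cong-O′ comm (suc m) n f k =
    trans (cong-O (^ᵒ-commute cong-O cong-O′ comm m n f) k) (commute-power n ((O ^ᵒ m) f) k)
    where
    commute-power : ∀ n → Commute O (O′ ^ᵒ n)
    commute-power zero    f k = refl
    commute-power (suc n) f k = trans (comm _ k) (cong-O′ (commute-power n f) k)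

DegreeAtMost : Seq → ℕ → Set
DegreeAtMost f n = ∀ j → n < j → f j ≡ 0

TopBounded : Seq → ℕ → ℕ → Set
TopBounded f n C = ∀ j d → j + d ≡ n → f j ≤ C * n ^ d

one-degree : DegreeAtMost one 0
one-degree (suc j) _ = refl

one-topBounded : TopBounded one 0 1
one-topBounded zero zero refl = ≤-refl

n^i≤[1+n]^j : ∀ n {i j} → i ≤ j → n ^ i ≤ suc n ^ j
n^i≤[1+n]^j n {i} i≤j = ≤-trans (^-monoˡ-≤ i (n≤1+n n)) (^-monoʳ-≤ (suc n) i≤j)

module _ {a b : ℕ} where

  mulLin-congruent : Congruent (mulLin a b)
  mulLin-congruent f≗g zero    = cong (a *_) (f≗g zero)
  mulLin-congruent f≗g (suc k) = cong₂ _+_ (cong (a *_) (f≗g (suc k))) (cong (b *_) (f≗g k))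

  mulLin-additive : Additive (mulLin a b)
  mulLin-additive f g zero    = *-distribˡ-+ a (f zero) (g zero)
  mulLin-additive f g (suc k) = distribute a b (f (suc k)) (g (suc k)) (f k) (g k)
    where
    distribute : ∀ a b x y x′ y′ → a * (x + y) + b * (x′ + y′) ≡ (a * x + b * x′) + (a * y + b * y′)
    distribute = solve-∀

  mulLin-commute : ∀ c d → Commute (mulLin a b) (mulLin c d)
  mulLin-commute c d f zero          = commutes₀ a c (f 0)
    where
    commutes₀ : ∀ a c x → a * (c * x) ≡ c * (a * x)
    commutes₀ = solve-∀
  mulLin-commute c d f (suc zero)    = commutes₁ a b c d (f 1) (f 0)
    where
    commutes₁ : ∀ a b c d x y → a * (c * x + d * y) + b * (c * y) ≡ c * (a * x + b * y) + d * (a * y)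
    commutes₁ = solve-∀
  mulLin-commute c d f (suc (suc k)) = commutes₂ a b c d (f (2 + k)) (f (1 + k)) (f k)
    where
    commutes₂ : ∀ a b c d x y z → a * (c * x + d * y) + b * (c * y + d * z) ≡ c * (a * x + b * y) + d * (a * y + b * z)
    commutes₂ = solve-∀

  mulLin-degree : ∀ {f n} → DegreeAtMost f n → DegreeAtMost (mulLin a b f) (suc n)
  mulLin-degree {f} {n} deg (suc j) (s≤s n<j) = begin
    a * f (suc j) + b * f j ≡⟨ cong₂ _+_ (cong (a *_) (deg (suc j) (m<n⇒m<1+n n<j))) (cong (b *_) (deg j n<j)) ⟩
    a * 0 + b * 0           ≡⟨ cong₂ _+_ (*-zeroʳ a) (*-zeroʳ b) ⟩
    0                       ∎
    where open ≡-Reasoning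

  mulLin-topBounded : ∀ {f n C K} → a ≤ K → b ≤ K → DegreeAtMost f n → TopBounded f n C →
                      TopBounded (mulLin a b f) (suc n) (K * C)
  mulLin-topBounded {f} {n} {C} {K} a≤K b≤K deg bound zero d refl = begin
    a * f 0               ≤⟨ *-mono-≤ a≤K (bound 0 n refl) ⟩
    K * (C * n ^ n)       ≡⟨ *-assoc K C (n ^ n) ⟨
    K * C * n ^ n         ≤⟨ *-monoʳ-≤ (K * C) (n^i≤[1+n]^j n (n≤1+n n)) ⟩
    K * C * suc n ^ suc n ∎
    where open ≤-Reasoning
  mulLin-topBounded {f} {n} {C} {K} a≤K b≤K deg bound (suc j) zero e = begin
    a * f (suc j) + b * f j ≡⟨ cong (λ v → a * v + b * f j) (deg (suc j) (≤-reflexive (cong suc (sym j≡n)))) ⟩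
    a * 0 + b * f j         ≡⟨ cong (_+ b * f j) (*-zeroʳ a) ⟩
    b * f j                 ≤⟨ *-mono-≤ b≤K (bound j 0 (suc-injective e)) ⟩
    K * (C * 1)             ≡⟨ *-assoc K C 1 ⟨
    K * C * 1               ∎
    where
    open ≤-Reasoning
    j≡n : j ≡ n
    j≡n = trans (sym (+-identityʳ j)) (suc-injective e)
  mulLin-topBounded {f} {n} {C} {K} a≤K b≤K deg bound (suc j) (suc d) e = begin
    a * f (suc j) + b * f j                   ≤⟨ +-mono-≤ (*-mono-≤ a≤K (bound (suc j) d (trans (sym (+-suc j d)) j+1+d≡n)))
                                                          (*-mono-≤ b≤K (bound j (suc d) j+1+d≡n)) ⟩
    K * (C * n ^ d) + K * (C * (n * n ^ d))   ≡⟨ factor K C n (n ^ d) ⟩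
    K * C * (suc n * n ^ d)                   ≤⟨ *-monoʳ-≤ (K * C) (*-monoʳ-≤ (suc n) (n^i≤[1+n]^j n {d} ≤-refl)) ⟩
    K * C * (suc n * suc n ^ d)               ∎
    where
    open ≤-Reasoning
    j+1+d≡n : j + suc d ≡ n
    j+1+d≡n = suc-injective e
    factor : ∀ K C n x → K * (C * x) + K * (C * (n * x)) ≡ K * C * (suc n * x)
    factor = solve-∀

  mulLin-lowerBound : ∀ f k → b * f k ≤ mulLin a b f (suc k)
  mulLin-lowerBound f k = m≤n+m (b * f k) (a * f (suc k))

  ^ᵒ-degree : ∀ {f n} → DegreeAtMost f n → ∀ e → DegreeAtMost ((mulLin a b ^ᵒ e) f) (e + n)
  ^ᵒ-degree deg zero    = deg
  ^ᵒ-degree deg (suc e) = mulLin-degree (^ᵒ-degree deg e)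

  ^ᵒ-topBounded : ∀ {f n C K} → a ≤ K → b ≤ K → DegreeAtMost f n → TopBounded f n C →
                  ∀ e → TopBounded ((mulLin a b ^ᵒ e) f) (e + n) (K ^ e * C)
  ^ᵒ-topBounded {C = C} a≤K b≤K deg bound zero rewrite *-identityˡ C = bound
  ^ᵒ-topBounded {C = C} {K} a≤K b≤K deg bound (suc e) rewrite *-assoc K (K ^ e) C =
    mulLin-topBounded a≤K b≤K (^ᵒ-degree deg e) (^ᵒ-topBounded a≤K b≤K deg bound e)

  ^ᵒ-lowerBound : ∀ f k e → b ^ e * f k ≤ (mulLin a b ^ᵒ e) f (e + k)
  ^ᵒ-lowerBound f k zero    = ≤-reflexive (*-identityˡ (f k))
  ^ᵒ-lowerBound f k (suc e) = begin
    b * b ^ e * f k                          ≡⟨ *-assoc b (b ^ e) (f k) ⟩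
    b * (b ^ e * f k)                        ≤⟨ *-monoʳ-≤ b (^ᵒ-lowerBound f k e) ⟩
    b * (mulLin a b ^ᵒ e) f (e + k)          ≤⟨ mulLin-lowerBound ((mulLin a b ^ᵒ e) f) (e + k) ⟩
    (mulLin a b ^ᵒ suc e) f (suc e + k)      ∎
    where open ≤-Reasoning

module _ {a b : ℕ} where

  mulLin^-congruent : ∀ e → Congruent (mulLin a b ^ᵒ e)
  mulLin^-congruent = ^ᵒ-congruent mulLin-congruent

  mulLin^-additive : ∀ e → Additive (mulLin a b ^ᵒ e)
  mulLin^-additive = ^ᵒ-additive mulLin-congruent mulLin-additive

  mulLin^-commute : ∀ {c d} m n → Commute (mulLin a b ^ᵒ m) (mulLin c d ^ᵒ n)
  mulLin^-commute {c} {d} = ^ᵒ-commute mulLin-congruent mulLin-congruent (mulLin-commute c d)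

^ᵒ-suc′ : ∀ (O : Seq → Seq) n f → (O ^ᵒ suc n) f ≡ (O ^ᵒ n) (O f)
^ᵒ-suc′ O n f = trans (cong (λ e → (O ^ᵒ e) f) (+-comm 1 n)) (cong-app (^ᵒ-homo O n 1) f)

^ᵒ-+ : ∀ (O : Seq → Seq) m n f → (O ^ᵒ m) ((O ^ᵒ n) f) ≡ (O ^ᵒ (m + n)) f
^ᵒ-+ O m n f = sym (cong-app (^ᵒ-homo O m n) f)

mulMonomial : ℕ → ℕ → ℕ → Seq → Seq
mulMonomial a b c f = (mul1+2z ^ᵒ a) ((mul1+z ^ᵒ b) ((mulZ ^ᵒ c) f))

mulMonomial-additive : ∀ a b c → Additive (mulMonomial a b c)
mulMonomial-additive a b c f g k = begin
  (P^ a) ((I^ b) ((Z^ c) (f ⊕ g))) k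
    ≡⟨ mulLin^-congruent a (mulLin^-congruent b (mulLin^-additive c f g)) k ⟩
  (P^ a) ((I^ b) ((Z^ c) f ⊕ (Z^ c) g)) k
    ≡⟨ mulLin^-congruent a (mulLin^-additive b _ _) k ⟩
  (P^ a) ((I^ b) ((Z^ c) f) ⊕ (I^ b) ((Z^ c) g)) k
    ≡⟨ mulLin^-additive a _ _ k ⟩
  mulMonomial a b c f k + mulMonomial a b c g k ∎
  where
  open ≡-Reasoning
  P^ I^ Z^ : ℕ → Seq → Seq
  P^ = mul1+2z ^ᵒ_
  I^ = mul1+z ^ᵒ_
  Z^ = mulZ ^ᵒ_

mulMonomial-one-degree : ∀ a b c → DegreeAtMost (mulMonomial a b c one) (a + (b + c))
mulMonomial-one-degree a b c =
  ^ᵒ-degree (^ᵒ-degree (subst (DegreeAtMost _) (+-identityʳ c) (^ᵒ-degree one-degree c)) b) a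

mulMonomial-one-topBounded : ∀ a b c → TopBounded (mulMonomial a b c one) (a + (b + c)) (2 ^ a)
mulMonomial-one-topBounded a b c = subst (TopBounded _ _) constant
  (^ᵒ-topBounded (s≤s z≤n) ≤-refl (^ᵒ-degree Zᶜ-degree b)
    (^ᵒ-topBounded ≤-refl ≤-refl Zᶜ-degree
      Zᶜ-topBounded b) a)
  where
  Zᶜ-degree : DegreeAtMost ((mulZ ^ᵒ c) one) c
  Zᶜ-degree = subst (DegreeAtMost _) (+-identityʳ c) (^ᵒ-degree one-degree c)
  Zᶜ-topBounded : TopBounded ((mulZ ^ᵒ c) one) c (1 ^ c * 1)
  Zᶜ-topBounded = subst (λ n → TopBounded ((mulZ ^ᵒ c) one) n (1 ^ c * 1)) (+-identityʳ c)
                        (^ᵒ-topBounded z≤n ≤-refl one-degree one-topBounded c)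
  constant : 2 ^ a * (1 ^ b * (1 ^ c * 1)) ≡ 2 ^ a
  constant rewrite ^-zeroˡ b | ^-zeroˡ c = *-identityʳ (2 ^ a)

-- multiplication by (1+2z)^t + z(1+z)^t, the independence polynomial of a branch of T_{m,t,1}
mulBranch : ℕ → Seq → Seq
mulBranch t f = (mul1+2z ^ᵒ t) f ⊕ mulZ ((mul1+z ^ᵒ t) f)

module _ (t : ℕ) where

  mulBranch-congruent : Congruent (mulBranch t)
  mulBranch-congruent f≗g k =
    cong₂ _+_ (mulLin^-congruent t f≗g k) (mulLin-congruent (mulLin^-congruent t f≗g) k)

  mulBranch-lowerBound : ∀ f k → 2 ^ t * f k ≤ mulBranch t f (t + k)
  mulBranch-lowerBound f k = ≤-trans (^ᵒ-lowerBound f k t) (m≤m+n _ _)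

  mulBranch-lowerBound-shifted : ∀ f k → f k ≤ mulBranch t f (suc (t + k))
  mulBranch-lowerBound-shifted f k = begin
    f k                                   ≡⟨ trans (sym (*-identityˡ (f k))) (cong (_* f k) (sym (^-zeroˡ t))) ⟩
    1 ^ t * f k                           ≤⟨ ^ᵒ-lowerBound f k t ⟩
    (mul1+z ^ᵒ t) f (t + k)               ≡⟨ *-identityˡ ((mul1+z ^ᵒ t) f (t + k)) ⟨
    1 * (mul1+z ^ᵒ t) f (t + k)           ≤⟨ mulLin-lowerBound {0} {1} ((mul1+z ^ᵒ t) f) (t + k) ⟩
    mulZ ((mul1+z ^ᵒ t) f) (suc (t + k))  ≤⟨ m≤n+m _ ((mul1+2z ^ᵒ t) f (suc (t + k))) ⟩
    mulBranch t f (suc (t + k))           ∎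
    where open ≤-Reasoning

  mulMonomial-mulBranch : ∀ a b c f → mulMonomial a b c (mulBranch t f) ≗
                          mulMonomial (a + t) b c f ⊕ mulMonomial a (b + t) (suc c) f
  mulMonomial-mulBranch a b c f k = begin
    mulMonomial a b c (mulBranch t f) k
      ≡⟨ mulMonomial-additive a b c _ _ k ⟩
    mulMonomial a b c ((mul1+2z ^ᵒ t) f) k + mulMonomial a b c (mulZ ((mul1+z ^ᵒ t) f)) k
      ≡⟨ cong₂ _+_ absorb-1+2z absorb-z ⟩
    mulMonomial (a + t) b c f k + mulMonomial a (b + t) (suc c) f k ∎
    where
    open ≡-Reasoning
    absorb-1+2z : mulMonomial a b c ((mul1+2z ^ᵒ t) f) k ≡ mulMonomial (a + t) b c f k
    absorb-1+2z = trans
      (mulLin^-congruent a (λ j → trans (mulLin^-congruent b (mulLin^-commute c t f) j)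
                                        (mulLin^-commute b t _ j)) k)
      (cong-app (^ᵒ-+ mul1+2z a t _) k)
    absorb-z : mulMonomial a b c (mulZ ((mul1+z ^ᵒ t) f)) k ≡ mulMonomial a (b + t) (suc c) f k
    absorb-z = trans
      (mulLin^-congruent a (mulLin^-congruent b (λ j →
         trans (cong-app (sym (^ᵒ-suc′ mulZ c _)) j) (mulLin^-commute (suc c) t f j))) k)
      (cong (λ g → (mul1+2z ^ᵒ a) g k) (^ᵒ-+ mul1+z b t _))

module CentralCoefficient (t m : ℕ) (m[mt+m]≤2^t : (m * t + m) * m ≤ 2 ^ t) where

  N ρ M : ℕ
  N = m * t
  ρ = 2 ^ t
  M = N + m

  -- Bounds ρ² [z^{N+2}] (1+2z)^a (1+z)^b z^c B^r in units of 2^{a+rt}. Until c ≥ 2 the remaining r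
  -- factors B must still supply 2 ∸ c terms z(1+z)^t in place of (1+2z)^t, each losing a factor ρ.
  potential : ℕ → ℕ → ℕ
  potential zero          r = r * r * r
  potential (suc zero)    r = ρ * (r * r)
  potential (suc (suc c)) r = ρ * ρ * M ^ c * suc r

  potential-step : ∀ c r → suc r ≤ m → ρ * potential c r + potential (suc c) r ≤ ρ * potential c (suc r)
  potential-step zero r _ = begin
    ρ * (r * r * r) + ρ * (r * r)                                 ≡⟨ lhs ρ r ⟩
    ρ * (r * r * r + r * r)                                       ≤⟨ *-monoʳ-≤ ρ (m≤m+n _ (2 * (r * r) + 3 * r + 1)) ⟩
    ρ * (r * r * r + r * r + (2 * (r * r) + 3 * r + 1))           ≡⟨ rhs ρ r ⟩
    ρ * (suc r * suc r * suc r)                                   ∎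
    where
    open ≤-Reasoning
    lhs : ∀ ρ r → ρ * (r * r * r) + ρ * (r * r) ≡ ρ * (r * r * r + r * r)
    lhs = solve-∀
    rhs : ∀ ρ r → ρ * (r * r * r + r * r + (2 * (r * r) + 3 * r + 1)) ≡ ρ * ((1 + r) * (1 + r) * (1 + r))
    rhs = solve-∀
  potential-step (suc zero) r _ = begin
    ρ * (ρ * (r * r)) + ρ * ρ * 1 * suc r                         ≡⟨ lhs ρ r ⟩
    ρ * ρ * (r * r + suc r)                                       ≤⟨ *-monoʳ-≤ (ρ * ρ) (m≤m+n (r * r + suc r) r) ⟩
    ρ * ρ * (r * r + suc r + r)                                   ≡⟨ rhs ρ r ⟩
    ρ * (ρ * (suc r * suc r))                                     ∎
    where
    open ≤-Reasoning
    lhs : ∀ ρ r → ρ * (ρ * (r * r)) + ρ * ρ * 1 * (1 + r) ≡ ρ * ρ * (r * r + (1 + r))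
    lhs = solve-∀
    rhs : ∀ ρ r → ρ * ρ * (r * r + (1 + r) + r) ≡ ρ * (ρ * ((1 + r) * (1 + r)))
    rhs = solve-∀
  potential-step (suc (suc c)) r r<m = begin
    ρ * (ρ * ρ * M ^ c * suc r) + ρ * ρ * (M * M ^ c) * suc r     ≡⟨ lhs ρ (M ^ c) M r ⟩
    ρ * ρ * M ^ c * (ρ * suc r + M * suc r)                       ≤⟨ *-monoʳ-≤ (ρ * ρ * M ^ c) (+-monoʳ-≤ (ρ * suc r) M[r+1]≤ρ) ⟩
    ρ * ρ * M ^ c * (ρ * suc r + ρ)                               ≡⟨ rhs ρ (M ^ c) r ⟩
    ρ * (ρ * ρ * M ^ c * suc (suc r))                             ∎
    where
    open ≤-Reasoning
    M[r+1]≤ρ : M * suc r ≤ ρ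
    M[r+1]≤ρ = ≤-trans (*-monoʳ-≤ M r<m) m[mt+m]≤2^t
    lhs : ∀ ρ X M r → ρ * (ρ * ρ * X * (1 + r)) + ρ * ρ * (M * X) * (1 + r) ≡ ρ * ρ * X * (ρ * (1 + r) + M * (1 + r))
    lhs = solve-∀
    rhs : ∀ ρ X r → ρ * ρ * X * (ρ * (1 + r) + ρ) ≡ ρ * (ρ * ρ * X * (1 + (1 + r)))
    rhs = solve-∀

  a+[b+c]≡N+c : ∀ a b c → a + b + 0 ≡ N → a + (b + c) ≡ N + c
  a+[b+c]≡N+c a b c e = trans (sym (+-assoc a b c)) (cong (_+ c) (trans (sym (+-identityʳ (a + b))) e))

  vanishing : ∀ a b c {x} → a + (b + c) < 2 + N → ρ * ρ * mulMonomial a b c one (2 + N) ≤ x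
  vanishing a b c lt = ≤-trans (≤-reflexive (trans (cong (ρ * ρ *_) (mulMonomial-one-degree a b c (2 + N) lt))
                                                   (*-zeroʳ (ρ * ρ)))) z≤n

  coefficient-bound : ∀ r a b c → a + b + r * t ≡ N → r + c ≤ m →
    ρ * ρ * mulMonomial a b c ((mulBranch t ^ᵒ r) one) (2 + N) ≤ 2 ^ (a + r * t) * potential c r
  coefficient-bound zero a b zero e _ =
    vanishing a b 0 (s≤s (≤-trans (≤-reflexive (trans (a+[b+c]≡N+c a b 0 e) (+-identityʳ N))) (n≤1+n N)))
  coefficient-bound zero a b (suc zero) e _ =
    vanishing a b 1 (s≤s (≤-reflexive (trans (a+[b+c]≡N+c a b 1 e) (+-comm N 1))))
  coefficient-bound zero a b (suc (suc c)) e 2+c≤m = begin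
    ρ * ρ * mulMonomial a b (2 + c) one (2 + N)       ≤⟨ *-monoʳ-≤ (ρ * ρ) (mulMonomial-one-topBounded a b (2 + c) (2 + N) c top) ⟩
    ρ * ρ * (2 ^ a * (a + (b + (2 + c))) ^ c)         ≤⟨ *-monoʳ-≤ (ρ * ρ) (*-monoʳ-≤ (2 ^ a) (^-monoˡ-≤ c deg≤M)) ⟩
    ρ * ρ * (2 ^ a * M ^ c)                           ≡⟨ rearrange ρ (2 ^ a) (M ^ c) ⟩
    2 ^ a * (ρ * ρ * M ^ c * 1)                       ≡⟨ cong (λ n → 2 ^ n * (ρ * ρ * M ^ c * 1)) (+-identityʳ a) ⟨
    2 ^ (a + 0) * potential (2 + c) 0                 ∎
    where
    open ≤-Reasoning
    shuffle : ∀ N c → 2 + N + c ≡ N + (2 + c)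
    shuffle = solve-∀
    top : 2 + N + c ≡ a + (b + (2 + c))
    top = trans (shuffle N c) (sym (a+[b+c]≡N+c a b (2 + c) e))
    deg≤M : a + (b + (2 + c)) ≤ M
    deg≤M = ≤-trans (≤-reflexive (a+[b+c]≡N+c a b (2 + c) e)) (+-monoʳ-≤ N 2+c≤m)
    rearrange : ∀ ρ E X → ρ * ρ * (E * X) ≡ E * (ρ * ρ * X * 1)
    rearrange = solve-∀
  coefficient-bound (suc r) a b c e r+1+c≤m = begin
    ρ * ρ * mulMonomial a b c ((mulBranch t ^ᵒ suc r) one) (2 + N)
      ≡⟨ cong (ρ * ρ *_) (mulMonomial-mulBranch t a b c Bʳ (2 + N)) ⟩
    ρ * ρ * (mulMonomial (a + t) b c Bʳ (2 + N) + mulMonomial a (b + t) (suc c) Bʳ (2 + N))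
      ≡⟨ *-distribˡ-+ (ρ * ρ) _ _ ⟩
    ρ * ρ * mulMonomial (a + t) b c Bʳ (2 + N) + ρ * ρ * mulMonomial a (b + t) (suc c) Bʳ (2 + N)
      ≤⟨ +-mono-≤ (coefficient-bound r (a + t) b c (trans (regroup₁ a t b (r * t)) e) (≤-trans (n≤1+n _) r+1+c≤m))
                  (coefficient-bound r a (b + t) (suc c) (trans (regroup₂ a t b (r * t)) e) (≤-trans (≤-reflexive (+-suc r c)) r+1+c≤m)) ⟩
    2 ^ (a + t + r * t) * potential c r + E * potential (suc c) r
      ≡⟨ cong (λ x → x * potential c r + E * potential (suc c) r) (2^[_]≡Eρ (regroup₃ a t (r * t))) ⟩
    E * ρ * potential c r + E * potential (suc c) r
      ≡⟨ factor E ρ (potential c r) (potential (suc c) r) ⟩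
    E * (ρ * potential c r + potential (suc c) r)
      ≤⟨ *-monoʳ-≤ E (potential-step c r (≤-trans (m≤m+n (suc r) c) r+1+c≤m)) ⟩
    E * (ρ * potential c (suc r))
      ≡⟨ trans (cong (_* potential c (suc r)) (2^[_]≡Eρ (regroup₄ a t (r * t)))) (*-assoc E ρ _) ⟨
    2 ^ (a + suc r * t) * potential c (suc r) ∎
    where
    open ≤-Reasoning
    Bʳ : Seq
    Bʳ = (mulBranch t ^ᵒ r) one
    E : ℕ
    E = 2 ^ (a + r * t)
    2^[_]≡Eρ : ∀ {n} → n ≡ a + r * t + t → 2 ^ n ≡ E * ρ
    2^[ refl ]≡Eρ = ^-distribˡ-+-* 2 (a + r * t) t
    regroup₁ : ∀ a t b x → a + t + b + x ≡ a + b + (t + x)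
    regroup₁ = solve-∀
    regroup₂ : ∀ a t b x → a + (b + t) + x ≡ a + b + (t + x)
    regroup₂ = solve-∀
    regroup₃ : ∀ a t x → a + t + x ≡ a + x + t
    regroup₃ = solve-∀
    regroup₄ : ∀ a t x → a + (t + x) ≡ a + x + t
    regroup₄ = solve-∀
    factor : ∀ E ρ G H → E * ρ * G + E * H ≡ E * (ρ * G + H)
    factor = solve-∀

  central-coefficient-bound : ρ * ρ * (mulBranch t ^ᵒ m) one (2 + N) ≤ 2 ^ N * (m * m * m)
  central-coefficient-bound = coefficient-bound m 0 0 0 refl (≤-reflexive (+-identityʳ m))

mulBranch^-lowerBound : ∀ t r → 2 ^ (r * t) ≤ (mulBranch t ^ᵒ r) one (r * t)
mulBranch^-lowerBound t zero    = ≤-refl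
mulBranch^-lowerBound t (suc r) = begin
  2 ^ (t + r * t)                                    ≡⟨ ^-distribˡ-+-* 2 t (r * t) ⟩
  2 ^ t * 2 ^ (r * t)                                ≤⟨ *-monoʳ-≤ (2 ^ t) (mulBranch^-lowerBound t r) ⟩
  2 ^ t * (mulBranch t ^ᵒ r) one (r * t)             ≤⟨ mulBranch-lowerBound t ((mulBranch t ^ᵒ r) one) (r * t) ⟩
  (mulBranch t ^ᵒ suc r) one (t + r * t)             ∎
  where open ≤-Reasoning

module _ {A : Set} where

  countB-++ : ∀ (p : A → Bool) us ys → countB p (us ++ ys) ≡ countB p us + countB p ys
  countB-++ p []       ys = refl
  countB-++ p (u ∷ us) ys with p u
  ... | true  = cong suc (countB-++ p us ys)
  ... | false = countB-++ p us ys

  countB-map : ∀ {B : Set} (p : B → Bool) (f : A → B) us → countB p (map f us) ≡ countB (p ∘ f) us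
  countB-map p f []       = refl
  countB-map p f (u ∷ us) with p (f u)
  ... | true  = cong suc (countB-map p f us)
  ... | false = countB-map p f us

  countB-cong : ∀ {p q : A → Bool} → p ≗ q → ∀ us → countB p us ≡ countB q us
  countB-cong p≗q []       = refl
  countB-cong p≗q (u ∷ us) rewrite p≗q u | countB-cong p≗q us = refl

  countB-false : ∀ us → countB (λ (_ : A) → false) us ≡ 0
  countB-false []       = refl
  countB-false (u ∷ us) = countB-false us

module _ {A : Set} where

  countB-sublists-∷ : ∀ (P : List A → Bool) v L →
    countB P (sublists (v ∷ L)) ≡ countB P (sublists L) + countB (P ∘ (v ∷_)) (sublists L)
  countB-sublists-∷ P v L = trans (countB-++ P (sublists L) (map (v ∷_) (sublists L)))
                                    (cong (countB P (sublists L) +_) (countB-map P (v ∷_) (sublists L)))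

  countB-sublists-filterᵇ : ∀ (q : A → Bool) (P : List A → Bool) L →
    countB (λ S → allB q S ∧ P S) (sublists L) ≡ countB P (sublists (filterᵇ q L))
  countB-sublists-filterᵇ q P []      = refl
  countB-sublists-filterᵇ q P (v ∷ L) with q v in qv
  ... | true  = begin
    countB (λ S → allB q S ∧ P S) (sublists (v ∷ L))
      ≡⟨ countB-sublists-∷ _ v L ⟩
    countB (λ S → allB q S ∧ P S) (sublists L) + countB (λ S → (q v ∧ allB q S) ∧ P (v ∷ S)) (sublists L)
      ≡⟨ cong₂ _+_ (countB-sublists-filterᵇ q P L)
                   (trans (countB-cong (λ S → cong (λ b → (b ∧ allB q S) ∧ P (v ∷ S)) qv) (sublists L))
                            (countB-sublists-filterᵇ q (P ∘ (v ∷_)) L)) ⟩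
    countB P (sublists (filterᵇ q L)) + countB (P ∘ (v ∷_)) (sublists (filterᵇ q L))
      ≡⟨ countB-sublists-∷ P v (filterᵇ q L) ⟨
    countB P (sublists (v ∷ filterᵇ q L)) ∎
    where open ≡-Reasoning
  ... | false = begin
    countB (λ S → allB q S ∧ P S) (sublists (v ∷ L))
      ≡⟨ countB-sublists-∷ _ v L ⟩
    countB (λ S → allB q S ∧ P S) (sublists L) + countB (λ S → (q v ∧ allB q S) ∧ P (v ∷ S)) (sublists L)
      ≡⟨ cong₂ _+_ (countB-sublists-filterᵇ q P L)
                   (trans (countB-cong (λ S → cong (λ b → (b ∧ allB q S) ∧ P (v ∷ S)) qv) (sublists L))
                            (countB-false (sublists L))) ⟩
    countB P (sublists (filterᵇ q L)) + 0
      ≡⟨ +-identityʳ _ ⟩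
    countB P (sublists (filterᵇ q L)) ∎
    where open ≡-Reasoning

  countB-sublists-↭ : ∀ {L L′} → L ↭ L′ → ∀ (P : List A → Bool) → (∀ {S S′} → S ↭ S′ → P S ≡ P S′) →
                      countB P (sublists L) ≡ countB P (sublists L′)
  countB-sublists-↭ ↭.refl P resp = refl
  countB-sublists-↭ {v ∷ L} {.v ∷ L′} (prep v L↭L′) P resp = begin
    countB P (sublists (v ∷ L))                                     ≡⟨ countB-sublists-∷ P v L ⟩
    countB P (sublists L) + countB (P ∘ (v ∷_)) (sublists L)        ≡⟨ cong₂ _+_ (countB-sublists-↭ L↭L′ P resp)
                                                                         (countB-sublists-↭ L↭L′ _ (resp ∘ prep v)) ⟩
    countB P (sublists L′) + countB (P ∘ (v ∷_)) (sublists L′)      ≡⟨ countB-sublists-∷ P v L′ ⟨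
    countB P (sublists (v ∷ L′))                                    ∎
    where open ≡-Reasoning
  countB-sublists-↭ {u ∷ v ∷ L} {.v ∷ .u ∷ L′} (swap u v L↭L′) P resp = begin
    countB P (sublists (u ∷ v ∷ L))
      ≡⟨ trans (countB-sublists-∷ P u (v ∷ L)) (cong₂ _+_ (countB-sublists-∷ P v L) (countB-sublists-∷ Pᵤ v L)) ⟩
    (# P L + # Pᵥ L) + (# Pᵤ L + # Pᵤᵥ L)
      ≡⟨ interchange₊ (# P L) _ _ _ ⟩
    (# P L + # Pᵤ L) + (# Pᵥ L + # Pᵤᵥ L)
      ≡⟨ cong₂ _+_ (cong₂ _+_ (countB-sublists-↭ L↭L′ P resp) (countB-sublists-↭ L↭L′ Pᵤ (resp ∘ prep u)))
                   (cong₂ _+_ (countB-sublists-↭ L↭L′ Pᵥ (resp ∘ prep v))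
                              (trans (countB-cong (λ S → resp (swap u v ↭.refl)) (sublists L))
                                       (countB-sublists-↭ L↭L′ Pᵥᵤ (resp ∘ prep v ∘ prep u)))) ⟩
    (# P L′ + # Pᵤ L′) + (# Pᵥ L′ + # Pᵥᵤ L′)
      ≡⟨ trans (countB-sublists-∷ P v (u ∷ L′)) (cong₂ _+_ (countB-sublists-∷ P u L′) (countB-sublists-∷ Pᵥ u L′)) ⟨
    countB P (sublists (v ∷ u ∷ L′)) ∎
    where
    open ≡-Reasoning
    # : (List A → Bool) → List A → ℕ
    # Q K = countB Q (sublists K)
    Pᵤ Pᵥ Pᵤᵥ Pᵥᵤ : List A → Bool
    Pᵤ S  = P (u ∷ S)
    Pᵥ S  = P (v ∷ S)
    Pᵤᵥ S = P (u ∷ v ∷ S)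
    Pᵥᵤ S = P (v ∷ u ∷ S)
    interchange₊ : ∀ a b c d → (a + b) + (c + d) ≡ (a + c) + (b + d)
    interchange₊ = solve-∀
  countB-sublists-↭ (↭.trans L↭L″ L″↭L′) P resp =
    trans (countB-sublists-↭ L↭L″ P resp) (countB-sublists-↭ L″↭L′ P resp)

  allB-↭ : ∀ (q : A → Bool) {S S′} → S ↭ S′ → allB q S ≡ allB q S′
  allB-↭ q ↭.refl                = refl
  allB-↭ q (prep v S↭S′)       = cong (q v ∧_) (allB-↭ q S↭S′)
  allB-↭ q (swap u v S↭S′)     rewrite allB-↭ q S↭S′ = x∙yz≈y∙xz (q u) (q v) _
  allB-↭ q (↭.trans S↭S″ S″↭S′) = trans (allB-↭ q S↭S″) (allB-↭ q S″↭S′)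

⌊suc≟suc⌋ : ∀ m n → ⌊ suc m ≟ℕ suc n ⌋ ≡ ⌊ m ≟ℕ n ⌋
⌊suc≟suc⌋ m n with m ≟ℕ n
... | yes m≡n = trans (isYes≗does _) (dec-true (suc m ≟ℕ suc n) (cong suc m≡n))
... | no  m≢n = trans (isYes≗does _) (dec-false (suc m ≟ℕ suc n) (m≢n ∘ suc-injective))

module IndependentSets {A : Set} (adj : A → A → Bool) where

  independentOfSize : ℕ → List A → Bool
  independentOfSize k S = ⌊ length S ≟ℕ k ⌋ ∧ independent adj S

  indep : List A → ℕ → ℕ
  indep L k = countB (independentOfSize k) (sublists L)

  indep-∷-zero : ∀ v L → indep (v ∷ L) 0 ≡ indep L 0
  indep-∷-zero v L = trans (countB-sublists-∷ (independentOfSize 0) v L)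
    (trans (cong (indep L 0 +_) (countB-false (sublists L))) (+-identityʳ _))

  indep-∷-suc : ∀ v L k → indep (v ∷ L) (suc k) ≡ indep L (suc k) + indep (filterᵇ (not ∘ adj v) L) k
  indep-∷-suc v L k = trans (countB-sublists-∷ (independentOfSize (suc k)) v L) (cong (indep L (suc k) +_)
    (trans (countB-cong (λ S → trans (cong (_∧ _) (⌊suc≟suc⌋ (length S) k))
                                         (x∙yz≈y∙xz ⌊ length S ≟ℕ k ⌋ (allB (not ∘ adj v) S) (independent adj S)))
                          (sublists L))
             (countB-sublists-filterᵇ (not ∘ adj v) (independentOfSize k) L)))

  module _ (adj-sym : ∀ u v → adj u v ≡ adj v u) where

    independent-↭ : ∀ {S S′} → S ↭ S′ → independent adj S ≡ independent adj S′
    independent-↭ ↭.refl          = refl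
    independent-↭ (prep v S↭S′) = cong₂ _∧_ (allB-↭ _ S↭S′) (independent-↭ S↭S′)
    independent-↭ {u ∷ v ∷ S} {.v ∷ .u ∷ S′} (swap u v S↭S′) = begin
      (not (adj u v) ∧ allB (not ∘ adj u) S) ∧ (allB (not ∘ adj v) S ∧ independent adj S)
        ≡⟨ cong₂ _∧_ (cong₂ _∧_ (cong not (adj-sym u v)) (allB-↭ _ S↭S′))
                     (cong₂ _∧_ (allB-↭ _ S↭S′) (independent-↭ S↭S′)) ⟩
      (not (adj v u) ∧ allB (not ∘ adj u) S′) ∧ (allB (not ∘ adj v) S′ ∧ independent adj S′)
        ≡⟨ interchange (not (adj v u)) _ _ _ ⟩
      (not (adj v u) ∧ allB (not ∘ adj v) S′) ∧ (allB (not ∘ adj u) S′ ∧ independent adj S′) ∎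
      where open ≡-Reasoning
    independent-↭ (↭.trans S↭S″ S″↭S′) = trans (independent-↭ S↭S″) (independent-↭ S″↭S′)

    indep-↭ : ∀ {L L′} → L ↭ L′ → ∀ k → indep L k ≡ indep L′ k
    indep-↭ L↭L′ k = countB-sublists-↭ L↭L′ (independentOfSize k)
      (λ S↭S′ → cong₂ _∧_ (cong (λ n → ⌊ n ≟ℕ k ⌋) (↭-length S↭S′)) (independent-↭ S↭S′))

  NonAdjacent : A → List A → Set
  NonAdjacent v = All (λ u → adj v u ≡ false)

  filterᵇ-nonAdjacent : ∀ {v L} → NonAdjacent v L → filterᵇ (not ∘ adj v) L ≡ L
  filterᵇ-nonAdjacent []                   = refl
  filterᵇ-nonAdjacent (u≁v ∷ L≁v) rewrite u≁v = cong (_ ∷_) (filterᵇ-nonAdjacent L≁v)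

  indep-isolated : ∀ {v L} → NonAdjacent v L → indep (v ∷ L) ≗ mul1+z (indep L)
  indep-isolated {v} {L} L≁v zero    = trans (indep-∷-zero v L) (sym (*-identityˡ (indep L 0)))
  indep-isolated {v} {L} L≁v (suc k) = begin
    indep (v ∷ L) (suc k)                                   ≡⟨ indep-∷-suc v L k ⟩
    indep L (suc k) + indep (filterᵇ (not ∘ adj v) L) k     ≡⟨ cong (λ K → indep L (suc k) + indep K k) (filterᵇ-nonAdjacent L≁v) ⟩
    indep L (suc k) + indep L k                             ≡⟨ cong₂ _+_ (*-identityˡ (indep L (suc k))) (*-identityˡ (indep L k)) ⟨
    mul1+z (indep L) (suc k)                                ∎
    where open ≡-Reasoning

  indep-edge : ∀ {u v L} → adj u v ≡ true → NonAdjacent u L → NonAdjacent v L →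
               indep (u ∷ v ∷ L) ≗ mul1+2z (indep L)
  indep-edge {u} {v} {L} u~v L≁u L≁v zero = trans (indep-∷-zero u (v ∷ L)) (indep-isolated L≁v 0)
  indep-edge {u} {v} {L} u~v L≁u L≁v (suc k) = begin
    indep (u ∷ v ∷ L) (suc k)                                   ≡⟨ indep-∷-suc u (v ∷ L) k ⟩
    indep (v ∷ L) (suc k) + indep (filterᵇ (not ∘ adj u) (v ∷ L)) k
      ≡⟨ cong₂ _+_ (indep-isolated L≁v (suc k)) (cong (λ K → indep K k) filter-v∷L) ⟩
    1 * indep L (suc k) + 1 * indep L k + indep L k             ≡⟨ regroup (indep L (suc k)) (indep L k) ⟩
    mul1+2z (indep L) (suc k)                                   ∎
    where
    open ≡-Reasoning
    filter-v∷L : filterᵇ (not ∘ adj u) (v ∷ L) ≡ L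
    filter-v∷L rewrite u~v = filterᵇ-nonAdjacent L≁u
    regroup : ∀ x y → 1 * x + 1 * y + y ≡ 1 * x + 2 * y
    regroup = solve-∀

⌊≟⌋-refl : ∀ {n} (i : Fin n) → ⌊ i ≟ i ⌋ ≡ true
⌊≟⌋-refl i = trans (isYes≗does (i ≟ i)) (dec-true (i ≟ i) refl)

⌊≟⌋-≢ : ∀ {n} {i j : Fin n} → i ≢ j → ⌊ i ≟ j ⌋ ≡ false
⌊≟⌋-≢ {i = i} {j} i≢j = trans (isYes≗does (i ≟ j)) (dec-false (i ≟ j) i≢j)

module TreeCount (m t : ℕ) where

  open IndependentSets (tAdj {m} {t})

  tAdj-sym : ∀ u v → tAdj {m} {t} u v ≡ tAdj v u
  tAdj-sym u v with edge u v | edge v u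
  ... | true  | true  = refl
  ... | true  | false = refl
  ... | false | true  = refl
  ... | false | false = refl

  pairs : Fin m → (s : ℕ) → (Fin s → Fin t) → List (TVtx m t)
  pairs i zero    g = []
  pairs i (suc s) g = x i (g fzero) ∷ y i (g fzero) ∷ pairs i s (g ∘ fsuc)

  leaves : Fin m → (s : ℕ) → (Fin s → Fin t) → List (TVtx m t)
  leaves i zero    g = []
  leaves i (suc s) g = y i (g fzero) ∷ leaves i s (g ∘ fsuc)

  branch : Fin m → List (TVtx m t)
  branch i = w i ∷ pairs i t id

  branches : (r : ℕ) → (Fin r → Fin m) → List (TVtx m t)
  branches zero    h = []
  branches (suc r) h = branch (h fzero) ++ branches r (h ∘ fsuc)

  allPairs : (r : ℕ) → (Fin r → Fin m) → List (TVtx m t)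
  allPairs zero    h = []
  allPairs (suc r) h = pairs (h fzero) t id ++ allPairs r (h ∘ fsuc)

  xs++ys↭pairs : ∀ i s (g : Fin s → Fin t) → map (x i) (tabulate g) ++ map (y i) (tabulate g) ↭ pairs i s g
  xs++ys↭pairs i zero    g = ↭-reflexive refl
  xs++ys↭pairs i (suc s) g = prep _ (↭-trans (shift (y i (g fzero)) (map (x i) (tabulate (g ∘ fsuc))) _)
                                             (prep _ (xs++ys↭pairs i s (g ∘ fsuc))))

  interleave : (a b c d e : List (TVtx m t)) → a ++ ((b ++ c) ++ (d ++ e)) ↭ (b ++ d) ++ (a ++ (c ++ e))
  interleave a b c d e = begin
    a ++ ((b ++ c) ++ (d ++ e))   ≡⟨ cong (a ++_) (++-assoc b c (d ++ e)) ⟩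
    a ++ b ++ c ++ d ++ e         ↭⟨ shifts a b ⟩
    b ++ a ++ c ++ d ++ e         ≡⟨ cong (b ++_) (++-assoc a c (d ++ e)) ⟨
    b ++ (a ++ c) ++ d ++ e       ↭⟨ ++⁺ˡ-↭ b (shifts (a ++ c) d) ⟩
    b ++ d ++ (a ++ c) ++ e       ≡⟨ cong (λ l → b ++ d ++ l) (++-assoc a c e) ⟩
    b ++ d ++ a ++ c ++ e         ≡⟨ ++-assoc b d _ ⟨
    (b ++ d) ++ a ++ c ++ e       ∎
    where open PermutationReasoning

  tVerts↭ : tVerts m t ↭ root ∷ branches m id
  tVerts↭ = prep root (grouped m id)
    where
    xs ys : Fin m → List (TVtx m t)
    xs i = map (x i) (allFin t)
    ys i = map (y i) (allFin t)
    grouped : ∀ r (h : Fin r → Fin m) →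
              map w (tabulate h) ++ (concatMap xs (tabulate h) ++ concatMap ys (tabulate h)) ↭ branches r h
    grouped zero    h = ↭-reflexive refl
    grouped (suc r) h = prep _ (↭-trans
      (interleave (map w (tabulate (h ∘ fsuc))) (xs (h fzero)) (concatMap xs (tabulate (h ∘ fsuc)))
                  (ys (h fzero)) (concatMap ys (tabulate (h ∘ fsuc))))
      (++⁺-↭ (xs++ys↭pairs (h fzero) t id) (grouped r (h ∘ fsuc))))

  tAdj-x-y : ∀ {i i′ j j′} → (i ≡ i′ → j ≢ j′) → tAdj {m} {t} (x i j) (y i′ j′) ≡ false
  tAdj-x-y {i} {i′} j≢j′ with i ≟ i′
  ... | yes i≡i′ rewrite ⌊≟⌋-≢ (j≢j′ i≡i′) = refl
  ... | no  _    = refl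

  tAdj-y-x : ∀ {i i′ j j′} → (i′ ≡ i → j′ ≢ j) → tAdj {m} {t} (y i j) (x i′ j′) ≡ false
  tAdj-y-x {i} {i′} j′≢j with i′ ≟ i
  ... | yes i′≡i = ⌊≟⌋-≢ (j′≢j i′≡i)
  ... | no  _    = refl

  tAdj-w-x : ∀ {i i′ j} → i ≢ i′ → tAdj {m} {t} (w i) (x i′ j) ≡ false
  tAdj-w-x i≢i′ rewrite ⌊≟⌋-≢ i≢i′ = refl

  tAdj-x-w : ∀ {i i′ j} → i′ ≢ i → tAdj {m} {t} (x i j) (w i′) ≡ false
  tAdj-x-w i′≢i rewrite ⌊≟⌋-≢ i′≢i = refl

  x-pairs : ∀ {i i′ j} s (g : Fin s → Fin t) → (∀ k → i ≡ i′ → j ≢ g k) → NonAdjacent (x i j) (pairs i′ s g)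
  x-pairs zero    g _   = []
  x-pairs (suc s) g j∉g = refl ∷ tAdj-x-y (j∉g fzero) ∷ x-pairs s (g ∘ fsuc) (j∉g ∘ fsuc)

  y-pairs : ∀ {i i′ j} s (g : Fin s → Fin t) → (∀ k → i ≡ i′ → j ≢ g k) → NonAdjacent (y i j) (pairs i′ s g)
  y-pairs zero    g _   = []
  y-pairs (suc s) g j∉g = tAdj-y-x (λ i′≡i gk≡j → j∉g fzero (sym i′≡i) (sym gk≡j)) ∷ refl ∷ y-pairs s (g ∘ fsuc) (j∉g ∘ fsuc)

  y-leaves : ∀ {i i′ j} s (g : Fin s → Fin t) → NonAdjacent (y i j) (leaves i′ s g)
  y-leaves zero    g = []
  y-leaves (suc s) g = refl ∷ y-leaves s (g ∘ fsuc)

  w-pairs : ∀ {i i′} s (g : Fin s → Fin t) → i ≢ i′ → NonAdjacent (w i) (pairs i′ s g)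
  w-pairs zero    g _    = []
  w-pairs (suc s) g i≢i′ = tAdj-w-x {j = g fzero} i≢i′ ∷ refl ∷ w-pairs s (g ∘ fsuc) i≢i′

  x-branches : ∀ {i j} r (h : Fin r → Fin m) → (∀ k → i ≢ h k) → NonAdjacent (x i j) (branches r h)
  x-branches zero    h _   = []
  x-branches {j = j} (suc r) h i∉h =
    ++⁺ (tAdj-x-w {j = j} (i∉h fzero ∘ sym) ∷ x-pairs t id (λ _ i≡h₀ → ⊥-elim (i∉h fzero i≡h₀)))
        (x-branches r (h ∘ fsuc) (i∉h ∘ fsuc))

  y-branches : ∀ {i j} r (h : Fin r → Fin m) → (∀ k → i ≢ h k) → NonAdjacent (y i j) (branches r h)
  y-branches zero    h _   = []
  y-branches (suc r) h i∉h = ++⁺ (refl ∷ y-pairs t id (λ _ i≡h₀ → ⊥-elim (i∉h fzero i≡h₀)))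
                                 (y-branches r (h ∘ fsuc) (i∉h ∘ fsuc))

  w-branches : ∀ {i} r (h : Fin r → Fin m) → (∀ k → i ≢ h k) → NonAdjacent (w i) (branches r h)
  w-branches zero    h _   = []
  w-branches (suc r) h i∉h = ++⁺ (refl ∷ w-pairs t id (i∉h fzero)) (w-branches r (h ∘ fsuc) (i∉h ∘ fsuc))

  filter-root : ∀ r (h : Fin r → Fin m) → filterᵇ (not ∘ tAdj root) (branches r h) ≡ allPairs r h
  filter-root zero    h = refl
  filter-root (suc r) h = trans (pairs++ t id) (cong (pairs (h fzero) t id ++_) (filter-root r (h ∘ fsuc)))
    where
    pairs++ : ∀ s (g : Fin s → Fin t) → filterᵇ (not ∘ tAdj root) (pairs (h fzero) s g ++ branches r (h ∘ fsuc))
                                      ≡ pairs (h fzero) s g ++ filterᵇ (not ∘ tAdj root) (branches r (h ∘ fsuc))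
    pairs++ zero    g = refl
    pairs++ (suc s) g = cong (λ l → x (h fzero) (g fzero) ∷ y (h fzero) (g fzero) ∷ l) (pairs++ s (g ∘ fsuc))

  filter-w : ∀ {i L} s (g : Fin s → Fin t) → NonAdjacent (w i) L →
             filterᵇ (not ∘ tAdj (w i)) (pairs i s g ++ L) ≡ leaves i s g ++ L
  filter-w zero    g L≁w = filterᵇ-nonAdjacent L≁w
  filter-w {i} (suc s) g L≁w rewrite ⌊≟⌋-refl i = cong (y i (g fzero) ∷_) (filter-w s (g ∘ fsuc) L≁w)

  module _ {i : Fin m} {L : List (TVtx m t)} (L≁x : ∀ j → NonAdjacent (x i j) L) (L≁y : ∀ j → NonAdjacent (y i j) L) where

    indep-pairs : ∀ s (g : Fin s → Fin t) → Injective _≡_ _≡_ g → indep (pairs i s g ++ L) ≗ (mul1+2z ^ᵒ s) (indep L)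
    indep-pairs zero    g _     k = refl
    indep-pairs (suc s) g g-inj k = trans
      (indep-edge x~y (++⁺ (x-pairs s (g ∘ fsuc) g₀∉) (L≁x (g fzero))) (++⁺ (y-pairs s (g ∘ fsuc) g₀∉) (L≁y (g fzero))) k)
      (mulLin-congruent (indep-pairs s (g ∘ fsuc) (fsuc-injective ∘ g-inj)) k)
      where
      g₀∉ : ∀ k → i ≡ i → g fzero ≢ g (fsuc k)
      g₀∉ k _ = 0≢1+n ∘ g-inj
      x~y : tAdj (x i (g fzero)) (y i (g fzero)) ≡ true
      x~y rewrite ⌊≟⌋-refl i | ⌊≟⌋-refl (g fzero) = refl

    indep-leaves : ∀ s (g : Fin s → Fin t) → indep (leaves i s g ++ L) ≗ (mul1+z ^ᵒ s) (indep L)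
    indep-leaves zero    g k = refl
    indep-leaves (suc s) g k = trans (indep-isolated (++⁺ (y-leaves s (g ∘ fsuc)) (L≁y (g fzero))) k)
                                     (mulLin-congruent (indep-leaves s (g ∘ fsuc)) k)

    indep-branch : NonAdjacent (w i) L → indep (branch i ++ L) ≗ mulBranch t (indep L)
    indep-branch L≁w zero = trans (indep-∷-zero (w i) (pairs i t id ++ L))
                                  (trans (indep-pairs t id id 0) (sym (+-identityʳ _)))
    indep-branch L≁w (suc k) = trans (indep-∷-suc (w i) (pairs i t id ++ L) k) (cong₂ _+_
      (indep-pairs t id id (suc k))
      (trans (cong (λ l → indep l k) (filter-w t id L≁w))
             (trans (indep-leaves t id k) (sym (*-identityˡ _)))))

  indep-[] : indep [] ≗ one
  indep-[] zero    = refl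
  indep-[] (suc k) = refl

  indep-branches : ∀ r (h : Fin r → Fin m) → Injective _≡_ _≡_ h → indep (branches r h) ≗ (mulBranch t ^ᵒ r) one
  indep-branches zero    h _     = indep-[]
  indep-branches (suc r) h h-inj k = trans
    (indep-branch (λ j → x-branches {j = j} r (h ∘ fsuc) h₀∉) (λ j → y-branches {j = j} r (h ∘ fsuc) h₀∉) (w-branches r (h ∘ fsuc) h₀∉) k)
    (mulBranch-congruent t (indep-branches r (h ∘ fsuc) (fsuc-injective ∘ h-inj)) k)
    where
    h₀∉ : ∀ k → h fzero ≢ h (fsuc k)
    h₀∉ k = 0≢1+n ∘ h-inj

  indep-allPairs : ∀ r (h : Fin r → Fin m) → Injective _≡_ _≡_ h → indep (allPairs r h) ≗ (mul1+2z ^ᵒ (r * t)) one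
  indep-allPairs zero    h _     = indep-[]
  indep-allPairs (suc r) h h-inj k = trans
    (indep-pairs (λ j → nonRoot {x (h fzero) j} (x-branches r (h ∘ fsuc) h₀∉)) (λ j → nonRoot {y (h fzero) j} (y-branches r (h ∘ fsuc) h₀∉)) t id id k)
    (trans (mulLin^-congruent t (indep-allPairs r (h ∘ fsuc) (fsuc-injective ∘ h-inj)) k)
           (cong-app (^ᵒ-+ mul1+2z t (r * t) one) k))
    where
    h₀∉ : ∀ k → h fzero ≢ h (fsuc k)
    h₀∉ k = 0≢1+n ∘ h-inj
    nonRoot : ∀ {v} → NonAdjacent v (branches r (h ∘ fsuc)) → NonAdjacent v (allPairs r (h ∘ fsuc))
    nonRoot = subst (NonAdjacent _) (filter-root r (h ∘ fsuc)) ∘ filter⁺ (T? ∘ (not ∘ tAdj root))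

indepCount-T : ∀ m t k → indepCount (T m t) (suc k) ≡ (mulBranch t ^ᵒ m) one (suc k) + (mul1+2z ^ᵒ (m * t)) one k
indepCount-T m t k = trans (indep-↭ tAdj-sym tVerts↭ (suc k)) (trans (indep-∷-suc root (branches m id) k)
  (cong₂ _+_ (indep-branches m id id (suc k))
             (trans (cong (λ l → indep l k) (filter-root m id)) (indep-allPairs m id id k))))
  where
  open TreeCount m t
  open IndependentSets (tAdj {m} {t})

square<product : ∀ {a b d} ρ Y c → 0 < Y → c * c < ρ → b ≤ ρ * Y * c → ρ * (ρ * (ρ * Y)) ≤ a → Y ≤ d → b ^ 2 < a * d
square<product {a} {b} {d} ρ Y c 0<Y c²<ρ b≤ρYc ρ³Y≤a Y≤d = begin-strict
  b ^ 2                             ≡⟨ cong (b *_) (*-identityʳ b) ⟩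
  b * b                             ≤⟨ *-mono-≤ b≤ρYc b≤ρYc ⟩
  ρ * Y * c * (ρ * Y * c)           ≡⟨ regroup₁ ρ Y c ⟩
  ρ * Y * (ρ * Y) * (c * c)         <⟨ *-monoʳ-< (ρ * Y * (ρ * Y)) {{m*n≢0 (ρ * Y) (ρ * Y) {{ρY≢0}} {{ρY≢0}}}} c²<ρ ⟩
  ρ * Y * (ρ * Y) * ρ               ≡⟨ regroup₂ ρ Y ⟩
  ρ * (ρ * (ρ * Y)) * Y             ≤⟨ *-mono-≤ ρ³Y≤a Y≤d ⟩
  a * d                             ∎
  where
  open ≤-Reasoning
  ρY≢0 : NonZero (ρ * Y)
  ρY≢0 = m*n≢0 ρ Y {{>-nonZero (<-≤-trans z<s c²<ρ)}} {{>-nonZero 0<Y}}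
  regroup₁ : ∀ ρ Y c → ρ * Y * c * (ρ * Y * c) ≡ ρ * Y * (ρ * Y) * (c * c)
  regroup₁ = solve-∀
  regroup₂ : ∀ ρ Y → ρ * Y * (ρ * Y) * ρ ≡ ρ * (ρ * (ρ * Y)) * Y
  regroup₂ = solve-∀

module _ (m t : ℕ) where

  private
    N : ℕ
    N = m * t

  indepCount-mt+1-lowerBound : 2 ^ N ≤ indepCount (T m t) (N + 1)
  indepCount-mt+1-lowerBound = begin
    2 ^ N                                                         ≡⟨ *-identityʳ (2 ^ N) ⟨
    2 ^ N * one 0                                                 ≤⟨ ^ᵒ-lowerBound one 0 N ⟩
    (mul1+2z ^ᵒ N) one (N + 0)                                    ≡⟨ cong ((mul1+2z ^ᵒ N) one) (+-identityʳ N) ⟩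
    (mul1+2z ^ᵒ N) one N                                          ≤⟨ m≤n+m _ _ ⟩
    (mulBranch t ^ᵒ m) one (suc N) + (mul1+2z ^ᵒ N) one N         ≡⟨ indepCount-T m t N ⟨
    indepCount (T m t) (suc N)                                    ≡⟨ cong (indepCount (T m t)) (+-comm 1 N) ⟩
    indepCount (T m t) (N + 1)                                    ∎
    where open ≤-Reasoning

  indepCount-mt+2 : indepCount (T m t) (N + 2) ≡ (mulBranch t ^ᵒ m) one (2 + N)
  indepCount-mt+2 = begin
    indepCount (T m t) (N + 2)                                    ≡⟨ cong (indepCount (T m t)) (+-comm N 2) ⟩
    indepCount (T m t) (2 + N)                                    ≡⟨ indepCount-T m t (suc N) ⟩
    (mulBranch t ^ᵒ m) one (2 + N) + (mul1+2z ^ᵒ N) one (suc N)   ≡⟨ cong ((mulBranch t ^ᵒ m) one (2 + N) +_) (^ᵒ-degree one-degree N (suc N) N+0<1+N) ⟩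
    (mulBranch t ^ᵒ m) one (2 + N) + 0                            ≡⟨ +-identityʳ _ ⟩
    (mulBranch t ^ᵒ m) one (2 + N)                                ∎
    where
    open ≡-Reasoning
    N+0<1+N : N + 0 < suc N
    N+0<1+N = s≤s (≤-reflexive (+-identityʳ N))

  indepCount-mt+2-upperBound : (N + m) * m ≤ 2 ^ t → 2 ^ t * 2 ^ t * indepCount (T m t) (N + 2) ≤ 2 ^ N * (m * m * m)
  indepCount-mt+2-upperBound hyp rewrite indepCount-mt+2 = central-coefficient-bound
    where open CentralCoefficient t m hyp

indepCount-mt+3-lowerBound : ∀ k t → 2 ^ (k * t) ≤ indepCount (T (3 + k) t) ((3 + k) * t + 3)
indepCount-mt+3-lowerBound k t = begin
  2 ^ (k * t)                                       ≤⟨ mulBranch^-lowerBound t k ⟩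
  Bᵏ one (k * t)                                    ≤⟨ mulBranch-lowerBound-shifted t _ _ ⟩
  Bᵏ⁺¹ one (suc (t + k * t))                        ≤⟨ mulBranch-lowerBound-shifted t _ _ ⟩
  Bᵏ⁺² one (suc (t + suc (t + k * t)))              ≤⟨ mulBranch-lowerBound-shifted t _ _ ⟩
  Bᵏ⁺³ one (suc (t + suc (t + suc (t + k * t))))    ≡⟨ cong (Bᵏ⁺³ one) (index t (k * t)) ⟩
  Bᵏ⁺³ one (3 + N)                                  ≤⟨ m≤m+n _ _ ⟩
  Bᵏ⁺³ one (3 + N) + (mul1+2z ^ᵒ N) one (2 + N)     ≡⟨ indepCount-T (3 + k) t (2 + N) ⟨
  indepCount (T (3 + k) t) (3 + N)                  ≡⟨ cong (indepCount (T (3 + k) t)) (+-comm 3 N) ⟩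
  indepCount (T (3 + k) t) (N + 3)                  ∎
  where
  open ≤-Reasoning
  N : ℕ
  N = (3 + k) * t
  Bᵏ Bᵏ⁺¹ Bᵏ⁺² Bᵏ⁺³ : Seq → Seq
  Bᵏ   = mulBranch t ^ᵒ k
  Bᵏ⁺¹ = mulBranch t ^ᵒ (1 + k)
  Bᵏ⁺² = mulBranch t ^ᵒ (2 + k)
  Bᵏ⁺³ = mulBranch t ^ᵒ (3 + k)
  index : ∀ t x → suc (t + suc (t + suc (t + x))) ≡ 3 + (t + (t + (t + x)))
  index = solve-∀

module _ (k t : ℕ) (t≤m : t ≤ 3 + k) (m¹⁶≤2ᵗ : (3 + k) ^ 16 ≤ 2 ^ t) where

  private
    m ρ Y c : ℕ
    m = 3 + k
    ρ = 2 ^ t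
    Y = 2 ^ (k * t)
    c = m * m * m

  2^mt≡ρ³Y : 2 ^ (m * t) ≡ ρ * (ρ * (ρ * Y))
  2^mt≡ρ³Y = trans (^-distribˡ-+-* 2 t _) (cong (ρ *_)
               (trans (^-distribˡ-+-* 2 t _) (cong (ρ *_) (^-distribˡ-+-* 2 t (k * t)))))

  m[mt+m]≤2ᵗ : (m * t + m) * m ≤ ρ
  m[mt+m]≤2ᵗ = begin
    (m * t + m) * m        ≤⟨ *-monoˡ-≤ m {m * t + m} {m * m + m * m} (+-mono-≤ (*-monoʳ-≤ m t≤m) (m≤m*n m m)) ⟩
    (m * m + m * m) * m    ≡⟨ regroup₁ m ⟩
    2 * m * (m * m)        ≤⟨ *-monoˡ-≤ (m * m) (*-monoˡ-≤ m {2} {m} (s≤s (s≤s z≤n))) ⟩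
    m * m * (m * m)        ≡⟨ regroup₂ m ⟩
    m ^ 4                  ≤⟨ ^-monoʳ-≤ m (m≤m+n 4 12) ⟩
    m ^ 16                 ≤⟨ m¹⁶≤2ᵗ ⟩
    ρ                      ∎
    where
    open ≤-Reasoning
    regroup₁ : ∀ m → (m * m + m * m) * m ≡ 2 * m * (m * m)
    regroup₁ = solve-∀
    regroup₂ : ∀ m → m * m * (m * m) ≡ m * (m * (m * (m * 1)))
    regroup₂ = solve-∀

  c²<2ᵗ : c * c < ρ
  c²<2ᵗ = begin-strict
    c * c    ≡⟨ regroup m ⟩
    m ^ 6    <⟨ ^-monoʳ-< m (s≤s (s≤s z≤n)) (m≤m+n 7 9) ⟩
    m ^ 16   ≤⟨ m¹⁶≤2ᵗ ⟩
    ρ        ∎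
    where
    open ≤-Reasoning
    regroup : ∀ m → m * m * m * (m * m * m) ≡ m * (m * (m * (m * (m * (m * 1)))))
    regroup = solve-∀

  indepCount-mt+2≤ρYc : indepCount (T m t) (m * t + 2) ≤ ρ * Y * c
  indepCount-mt+2≤ρYc = *-cancelˡ-≤ (ρ * ρ) {{m*n≢0 ρ ρ {{ρ≢0}} {{ρ≢0}}}} (begin
    ρ * ρ * indepCount (T m t) (m * t + 2)  ≤⟨ indepCount-mt+2-upperBound m t m[mt+m]≤2ᵗ ⟩
    2 ^ (m * t) * c                          ≡⟨ cong (_* c) 2^mt≡ρ³Y ⟩
    ρ * (ρ * (ρ * Y)) * c                    ≡⟨ regroup ρ Y c ⟩
    ρ * ρ * (ρ * Y * c)                      ∎)
    where
    open ≤-Reasoning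
    ρ≢0 : NonZero ρ
    ρ≢0 = >-nonZero (m^n>0 2 t)
    regroup : ∀ ρ Y c → ρ * (ρ * (ρ * Y)) * c ≡ ρ * ρ * (ρ * Y * c)
    regroup = solve-∀

  log-concavity-broken : indepCount (T m t) (m * t + 2) ^ 2 < indepCount (T m t) (m * t + 1) * indepCount (T m t) (m * t + 3)
  log-concavity-broken = square<product ρ Y c (m^n>0 2 (k * t)) c²<2ᵗ indepCount-mt+2≤ρYc
    (≤-trans (≤-reflexive (sym 2^mt≡ρ³Y)) (indepCount-mt+1-lowerBound m t)) (indepCount-mt+3-lowerBound k t)

theorem2p1 : (m : ℕ → ℕ) → (∀ t → 1 ≤ m t) →
    Σ ℕ λ t₀ → ∀ t → t₀ ≤ t → t ≤ m t → m t ^ 16 ≤ 2 ^ t →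
      indepCount (T (m t) t) (m t * t + 2) ^ 2
        < indepCount (T (m t) t) (m t * t + 1) * indepCount (T (m t) t) (m t * t + 3)
-- the hypothesis 1 ≤ m t is implied by 3 ≤ t ≤ m t
theorem2p1 m _ = 3 , λ t 3≤t t≤mₜ → broken (m t) t (≤-trans 3≤t t≤mₜ) t≤mₜ
  where
  broken : ∀ n t → 3 ≤ n → t ≤ n → n ^ 16 ≤ 2 ^ t →
           indepCount (T n t) (n * t + 2) ^ 2 < indepCount (T n t) (n * t + 1) * indepCount (T n t) (n * t + 3)
  broken (suc (suc (suc k))) t _                  = log-concavity-broken k t
  broken (suc (suc zero))    t (s≤s (s≤s ()))
  broken (suc zero)          t (s≤s ())
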